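{- Let $d\ge1$, $S=z_1+\cdots+z_d$, and define $B^{(1)}_{\mathbf v}$, $\mathbf v\in\mathbb N_0^d$, by $\sum_{\mathbf v\in\mathbb N_0^d} B^{(1)}_{\mathbf v}\frac{\mathbf z^{\mathbf v}}{\mathbf v!}=\frac{S}{e^S-1}$. Then for every $\mathbf v\in\mathbb N_0^d$ with $|\mathbf v|>1$, $$B^{(1)}_{\mathbf v}=\sum_{\mathbf k\le \mathbf v}\binom{\mathbf v}{\mathbf k}B^{(1)}_{\mathbf k}.$$
   Context: For $\mathbf v,\mathbf k\in\mathbb N_0^d$: $|\mathbf v|=v_1+\cdots+v_d$, $\mathbf v!=v_1!\cdots v_d!$, $\mathbf z^{\mathbf v}=z_1^{v_1}\cdots z_d^{v_d}$, $\binom{\mathbf v}{\mathbf k}=\prod_{j=1}^d\binom{v_j}{k_j}$, and $\mathbf k\le\mathbf v$ means $k_j\le v_j$ for all $j$. -}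

module Defs where

open import Data.Nat as ℕ using (ℕ; zero; suc; _≡ᵇ_)
open import Data.Nat.Combinatorics using (_C_)
open import Data.Bool using (if_then_else_)
open import Data.Vec as Vec using (Vec; []; _∷_; zipWith)
open import Data.List as List using (List; []; _∷_; map; concatMap; upTo)
open import Data.Integer using (+_)
open import Data.Rational using (ℚ; 0ℚ; 1ℚ; _+_; _*_; _-_; _/_)

∣_∣ : ∀ {d} → Vec ℕ d → ℕ
∣ v ∣ = Vec.sum v

below : ∀ {d} → Vec ℕ d → List (Vec ℕ d)
below [] = [] ∷ []
below (n ∷ v) = concatMap (λ k → map (k ∷_) (below v)) (upTo (suc n))

binomᵥ : ∀ {d} → Vec ℕ d → Vec ℕ d → ℕ
binomᵥ v k = Vec.foldr _ ℕ._*_ 1 (zipWith _C_ v k)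

-- componentwise truncated subtraction (used only for k ≤ v)
_∸ᵥ_ : ∀ {d} → Vec ℕ d → Vec ℕ d → Vec ℕ d
v ∸ᵥ k = zipWith ℕ._∸_ v k

ℕ→ℚ : ℕ → ℚ
ℕ→ℚ n = (+ n) / 1

Σ≤ : ∀ {d} → Vec ℕ d → (Vec ℕ d → ℚ) → ℚ
Σ≤ v f = List.foldr (λ k acc → f k + acc) 0ℚ (below v)

-- A formal power series in z₁,…,z_d over ℚ, written in exponential form
-- Σ_v F(v) z^v / v!, is represented by its coefficient family F.
EGF : ℕ → Set
EGF d = Vec ℕ d → ℚ

-- Product of formal power series in exponential form:
-- (Σ F_v z^v/v!)(Σ G_v z^v/v!) = Σ_v (Σ_{k≤v} binom(v,k) F_k G_{v-k}) z^v/v!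
_⋆_ : ∀ {d} → EGF d → EGF d → EGF d
(F ⋆ G) v = Σ≤ v (λ k → ℕ→ℚ (binomᵥ v k) * (F k * G (v ∸ᵥ k)))

_−_ : ∀ {d} → EGF d → EGF d → EGF d
(F − G) v = F v - G v

oneS : ∀ {d} → EGF d
oneS v = if ∣ v ∣ ≡ᵇ 0 then 1ℚ else 0ℚ

-- S = z₁ + ⋯ + z_d : coefficient of z^v/v! is 1 iff v is a unit vector (|v| = 1).
Sser : ∀ {d} → EGF d
Sser v = if ∣ v ∣ ≡ᵇ 1 then 1ℚ else 0ℚ

-- e^S = e^{z₁} ⋯ e^{z_d} = Σ_v z^v / v! : every exponential coefficient is 1.
expS : ∀ {d} → EGF d
expS v = 1ℚ

-- B is the coefficient family of S/(e^S − 1), i.e. B · (e^S − 1) = S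
-- as formal power series (this determines B uniquely, since e^S − 1 ≠ 0
-- and ℚ[[z]] is an integral domain).
IsBernoulli1 : ∀ {d} → EGF d → Set
IsBernoulli1 {d} B = ∀ (v : Vec ℕ d) → (B ⋆ (expS − oneS)) v ≡ Sser v
  where open import Relation.Binary.PropositionalEquality using (_≡_)

module Submission where

-- Write e^S − 1 in exponential form: its coefficient at
-- z^w/w! is 1 for w ≠ 0 and 0 for w = 0.  Hence, by the product formula for
-- exponential series, for every coefficient family B and every v
--
--   (B · (e^S − 1))_v = Σ_{k ≤ v} binom(v,k) B_k [v − k ≠ 0]
--                     = Σ_{k ≤ v} binom(v,k) B_k  −  B_v ,
--
-- because the only k ≤ v with v − k = 0 is k = v, where binom(v,v) = 1.
-- If B is the Bernoulli family, the left side equals S_v, which vanishes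
-- when |v| > 1 (S is homogeneous of degree 1); rearranging gives the claim.

open import Defs
open import Data.Nat as ℕ using (ℕ; zero; suc; _≤_; _<_; _≡ᵇ_; _∸_)
open import Data.Nat.Properties using (n∸n≡0; m>n⇒m∸n≢0)
open import Data.Nat.Combinatorics using (nCn≡1)
open import Data.Bool using (Bool; true; false; if_then_else_)
open import Data.Vec using (Vec; []; _∷_)
open import Data.List using (List; []; _∷_; foldr; map; concatMap; upTo; _++_; _∷ʳ_)
open import Data.List.Properties using (upTo-∷ʳ)
open import Data.List.Relation.Unary.All as All using (All; []; _∷_)
open import Data.List.Relation.Unary.All.Properties using (all-upTo)
open import Data.Rational using (ℚ; 0ℚ; 1ℚ; _+_; _-_; _*_)
open import Data.Rational.Properties
  using (+-identityˡ; +-identityʳ; +-assoc; +-inverseʳ; *-zeroʳ; *-identityˡ; *-identityʳ)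
open import Data.Rational.Solver using (module +-*-Solver)
open import Relation.Nullary using (¬_)
open import Relation.Binary.PropositionalEquality
  using (_≡_; refl; sym; trans; cong; cong₂; module ≡-Reasoning)

open +-*-Solver using (solve; _:+_; _:-_; _:=_)

sumOver : {A : Set} → List A → (A → ℚ) → ℚ
sumOver xs f = foldr (λ x acc → f x + acc) 0ℚ xs

module _ {A : Set} where

  sumOver-++ : (xs ys : List A) (f : A → ℚ) →
    sumOver (xs ++ ys) f ≡ sumOver xs f + sumOver ys f
  sumOver-++ []       ys f = sym (+-identityˡ _)
  sumOver-++ (x ∷ xs) ys f =
    trans (cong (f x +_) (sumOver-++ xs ys f)) (sym (+-assoc (f x) _ _))

  sumOver-cong : (xs : List A) {f g : A → ℚ} → (∀ x → f x ≡ g x) →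
    sumOver xs f ≡ sumOver xs g
  sumOver-cong []       f≗g = refl
  sumOver-cong (x ∷ xs) f≗g = cong₂ _+_ (f≗g x) (sumOver-cong xs f≗g)

  sumOver-zero : (xs : List A) {f : A → ℚ} → All (λ x → f x ≡ 0ℚ) xs →
    sumOver xs f ≡ 0ℚ
  sumOver-zero []       []         = refl
  sumOver-zero (x ∷ xs) (fx≡0 ∷ z) =
    trans (cong₂ _+_ fx≡0 (sumOver-zero xs z)) (+-identityˡ 0ℚ)

  sumOver-difference : (xs : List A) (f g : A → ℚ) →
    sumOver xs (λ x → f x - g x) ≡ sumOver xs f - sumOver xs g
  sumOver-difference []       f g = refl
  sumOver-difference (x ∷ xs) f g =
    trans (cong (f x - g x +_) (sumOver-difference xs f g))
          (interchange (f x) (g x) (sumOver xs f) (sumOver xs g))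
    where
    interchange : ∀ a b c e → (a - b) + (c - e) ≡ (a + c) - (b + e)
    interchange = solve 4 (λ a b c e → (a :- b) :+ (c :- e) := (a :+ c) :- (b :+ e)) refl

  sumOver-map : {B : Set} (g : A → B) (xs : List A) (f : B → ℚ) →
    sumOver (map g xs) f ≡ sumOver xs (λ x → f (g x))
  sumOver-map g []       f = refl
  sumOver-map g (x ∷ xs) f = cong (f (g x) +_) (sumOver-map g xs f)

sumOver-concatMap : {A B : Set} (g : A → List B) (xs : List A) (f : B → ℚ) →
  sumOver (concatMap g xs) f ≡ sumOver xs (λ x → sumOver (g x) f)
sumOver-concatMap g []       f = refl
sumOver-concatMap g (x ∷ xs) f =
  trans (sumOver-++ (g x) (concatMap g xs) f)
        (cong (sumOver (g x) f +_) (sumOver-concatMap g xs f))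

-- The box {k ≤ n ∷ v} is the union of the slices {j} × {k ≤ v} for j ≤ n;
-- we split off the top slice j = n, which is where the diagonal k = v lies.
Σ≤-peel : ∀ {d} (n : ℕ) (v : Vec ℕ d) (f : Vec ℕ (suc d) → ℚ) →
  Σ≤ (n ∷ v) f ≡ sumOver (upTo n) (λ j → Σ≤ v (λ k → f (j ∷ k))) + Σ≤ v (λ k → f (n ∷ k))
Σ≤-peel n v f = begin
  Σ≤ (n ∷ v) f
    ≡⟨ sumOver-concatMap slice (upTo (suc n)) f ⟩
  sumOver (upTo (suc n)) slice-sum
    ≡⟨ cong (λ js → sumOver js slice-sum) (sym (upTo-∷ʳ n)) ⟩
  sumOver (upTo n ∷ʳ n) slice-sum
    ≡⟨ sumOver-++ (upTo n) (n ∷ []) slice-sum ⟩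
  sumOver (upTo n) slice-sum + (slice-sum n + 0ℚ)
    ≡⟨ cong₂ _+_ (sumOver-cong (upTo n) (λ j → sumOver-map (j ∷_) (below v) f))
                 (trans (+-identityʳ _) (sumOver-map (n ∷_) (below v) f)) ⟩
  sumOver (upTo n) (λ j → Σ≤ v (λ k → f (j ∷ k))) + Σ≤ v (λ k → f (n ∷ k)) ∎
  where
  open ≡-Reasoning
  slice : ℕ → List (Vec ℕ _)
  slice j = map (j ∷_) (below v)
  slice-sum : ℕ → ℚ
  slice-sum j = sumOver (slice j) f

-- Test for "v − k = 0", i.e. k = v when k ≤ v.
isDiagonal : ∀ {d} → Vec ℕ d → Vec ℕ d → Bool
isDiagonal v k = ∣ v ∸ᵥ k ∣ ≡ᵇ 0

onDiagonal : ∀ {d} → Vec ℕ d → Vec ℕ d → ℚ → ℚ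
onDiagonal v k x = if isDiagonal v k then x else 0ℚ

-- Below the top slice the diagonal is never reached: the first
-- coordinate of v − k is n − j > 0.
offDiagonal-below : ∀ {d} {n j : ℕ} (v k : Vec ℕ d) (x : ℚ) → j < n →
  onDiagonal (n ∷ v) (j ∷ k) x ≡ 0ℚ
offDiagonal-below {n = n} {j} v k x j<n = positive (n ∸ j) (m>n⇒m∸n≢0 j<n)
  where
  positive : ∀ m → ¬ m ≡ 0 → (if (m ℕ.+ ∣ v ∸ᵥ k ∣) ≡ᵇ 0 then x else 0ℚ) ≡ 0ℚ
  positive zero    m≢0 with () ← m≢0 refl
  positive (suc m) m≢0 = refl

onDiagonal-top : ∀ {d} (n : ℕ) (v k : Vec ℕ d) (x : ℚ) →
  onDiagonal (n ∷ v) (n ∷ k) x ≡ onDiagonal v k x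
onDiagonal-top n v k x rewrite n∸n≡0 n = refl

Σ≤-onDiagonal : ∀ {d} (v : Vec ℕ d) (h : Vec ℕ d → ℚ) →
  Σ≤ v (λ k → onDiagonal v k (h k)) ≡ h v
Σ≤-onDiagonal []      h = +-identityʳ (h [])
Σ≤-onDiagonal (n ∷ v) h = begin
  Σ≤ (n ∷ v) (λ k → onDiagonal (n ∷ v) k (h k))
    ≡⟨ Σ≤-peel n v (λ k → onDiagonal (n ∷ v) k (h k)) ⟩
  lowerSlices + Σ≤ v (λ k → onDiagonal (n ∷ v) (n ∷ k) (h (n ∷ k)))
    ≡⟨ cong₂ _+_ lowerSlices≡0 (sumOver-cong (below v) (λ k → onDiagonal-top n v k (h (n ∷ k)))) ⟩
  0ℚ + Σ≤ v (λ k → onDiagonal v k (h (n ∷ k)))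
    ≡⟨ +-identityˡ _ ⟩
  Σ≤ v (λ k → onDiagonal v k (h (n ∷ k)))
    ≡⟨ Σ≤-onDiagonal v (λ k → h (n ∷ k)) ⟩
  h (n ∷ v) ∎
  where
  open ≡-Reasoning
  lowerSlices : ℚ
  lowerSlices = sumOver (upTo n) (λ j → Σ≤ v (λ k → onDiagonal (n ∷ v) (j ∷ k) (h (j ∷ k))))
  lowerSlices≡0 : lowerSlices ≡ 0ℚ
  lowerSlices≡0 = sumOver-zero (upTo n) (All.map slice≡0 (all-upTo n))
    where
    slice≡0 : ∀ {j} → j < n → Σ≤ v (λ k → onDiagonal (n ∷ v) (j ∷ k) (h (j ∷ k))) ≡ 0ℚ
    slice≡0 j<n = sumOver-zero (below v)
      (All.universal (λ k → offDiagonal-below v k (h _) j<n) (below v))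

binomᵥ-diagonal : ∀ {d} (v : Vec ℕ d) → binomᵥ v v ≡ 1
binomᵥ-diagonal []      = refl
binomᵥ-diagonal (n ∷ v) rewrite nCn≡1 n | binomᵥ-diagonal v = refl

-- The coefficient of e^S − 1 at z^w/w! is 1 − [w = 0]; multiplied into a
-- term c·b of the product formula it removes exactly the diagonal part.
times-expS−oneS : ∀ {d} (v k : Vec ℕ d) (c b : ℚ) →
  c * (b * (expS {d} (v ∸ᵥ k) - oneS (v ∸ᵥ k))) ≡ c * b - onDiagonal v k (c * b)
times-expS−oneS v k c b with isDiagonal v k
... | true  = begin
  c * (b * (1ℚ - 1ℚ))  ≡⟨ cong (λ x → c * (b * x)) (+-inverseʳ 1ℚ) ⟩
  c * (b * 0ℚ)         ≡⟨ cong (c *_) (*-zeroʳ b) ⟩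
  c * 0ℚ               ≡⟨ *-zeroʳ c ⟩
  0ℚ                   ≡⟨ sym (+-inverseʳ (c * b)) ⟩
  c * b - c * b        ∎
  where open ≡-Reasoning
... | false = begin
  c * (b * (1ℚ - 0ℚ))  ≡⟨ cong (λ x → c * (b * x)) (+-identityʳ 1ℚ) ⟩
  c * (b * 1ℚ)         ≡⟨ cong (c *_) (*-identityʳ b) ⟩
  c * b                ≡⟨ sym (+-identityʳ (c * b)) ⟩
  c * b - 0ℚ           ∎
  where open ≡-Reasoning

⋆-expS−oneS : ∀ {d} (B : EGF d) (v : Vec ℕ d) →
  (B ⋆ (expS − oneS)) v ≡ Σ≤ v (λ k → ℕ→ℚ (binomᵥ v k) * B k) - B v
⋆-expS−oneS B v = begin
  (B ⋆ (expS − oneS)) v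
    ≡⟨ sumOver-cong (below v) (λ k → times-expS−oneS v k (ℕ→ℚ (binomᵥ v k)) (B k)) ⟩
  Σ≤ v (λ k → term k - onDiagonal v k (term k))
    ≡⟨ sumOver-difference (below v) term (λ k → onDiagonal v k (term k)) ⟩
  Σ≤ v term - Σ≤ v (λ k → onDiagonal v k (term k))
    ≡⟨ cong (Σ≤ v term -_) (Σ≤-onDiagonal v term) ⟩
  Σ≤ v term - ℕ→ℚ (binomᵥ v v) * B v
    ≡⟨ cong (λ c → Σ≤ v term - ℕ→ℚ c * B v) (binomᵥ-diagonal v) ⟩
  Σ≤ v term - 1ℚ * B v
    ≡⟨ cong (Σ≤ v term -_) (*-identityˡ (B v)) ⟩
  Σ≤ v term - B v ∎
  where
  open ≡-Reasoning
  term : Vec ℕ _ → ℚ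
  term k = ℕ→ℚ (binomᵥ v k) * B k

Sser-vanishes : ∀ {d} (v : Vec ℕ d) → 1 < ∣ v ∣ → Sser v ≡ 0ℚ
Sser-vanishes v 1<|v| with ∣ v ∣ | 1<|v|
... | suc (suc m) | _            = refl
... | suc zero    | ℕ.s≤s ()

difference-zero : ∀ (s b : ℚ) → s - b ≡ 0ℚ → b ≡ s
difference-zero s b s-b≡0 = begin
  b              ≡⟨ sym (+-identityˡ b) ⟩
  0ℚ + b         ≡⟨ cong (_+ b) (sym s-b≡0) ⟩
  (s - b) + b    ≡⟨ cancel s b ⟩
  s              ∎
  where
  open ≡-Reasoning
  cancel : ∀ s b → (s - b) + b ≡ s
  cancel = solve 2 (λ s b → (s :- b) :+ b := s) refl

proposition2p4 : (d : ℕ) → 1 ≤ d → (B : EGF d) → IsBernoulli1 B →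
    (v : Vec ℕ d) → 1 < ∣ v ∣ →
    B v ≡ Σ≤ v (λ k → ℕ→ℚ (binomᵥ v k) * B k)
proposition2p4 d _ B isBernoulli v 1<|v| =
  difference-zero (Σ≤ v (λ k → ℕ→ℚ (binomᵥ v k) * B k)) (B v) (begin
    Σ≤ v (λ k → ℕ→ℚ (binomᵥ v k) * B k) - B v  ≡⟨ sym (⋆-expS−oneS B v) ⟩
    (B ⋆ (expS − oneS)) v                        ≡⟨ isBernoulli v ⟩
    Sser v                                       ≡⟨ Sser-vanishes v 1<|v| ⟩
    0ℚ                                           ∎)
  where open ≡-Reasoning
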